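{- Let $V$ be a finite set, $\mathcal{R}$ a dense set of rooted triplets on $V$, and $\mathcal{C}$ a conflict packing of $(V,\mathcal{R})$. Then there exists a rooted binary tree $T$ over $V$ such that every triplet $t\in\mathcal{R}$ inconsistent with $T$ satisfies $V(t)\subseteq V(\mathcal{C})$.
   Context: Rooted triplets $ab|c$ on 3-subsets of $V$; $\mathcal{R}$ is dense if it contains exactly one triplet on each 3-subset of $V$. A triplet $t$ is consistent with a rooted binary tree $T$ over $V$ (leaves in bijection with $V$) if the subtree of $T$ spanning $V(t)$ is homeomorphic to $t$. A conflict is a 4-set $C\subseteq V$ such that no rooted binary tree over $C$ is consistent with all triplets of $\mathcal{R}[C]=\{t\in\mathcal{R}:V(t)\subseteq C\}$. A leaf $a$ of a conflict $\{a,b,c,d\}$ is a seed if $\{a,b,c,d\}$ remains a conflict whichever of the three rooted triplets on $\{b,c,d\}$ is used in place of the one in $\mathcal{R}$. A conflict packing is a sequence of conflicts $C_1,\dots,C_l$ such that for each $2\le i\le l$, either $|C_i\cap\bigcup_{j<i}C_j|\le 2$, or $C_i$ has exactly one leaf not in $\bigcup_{j<i}C_j$ and that leaf is a seed of $C_i$; and which is maximal, i.e. cannot be extended by appending a further conflict satisfying this condition. $V(\mathcal{C})=\bigcup_i C_i$. -}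

module Defs where

open import Data.Nat using (ℕ; _≤_)
open import Data.Bool using (Bool; true; false; _∧_; _∨_; not; if_then_else_)
open import Data.Fin using (Fin; _≟_)
open import Data.Fin.Subset using (Subset; _∩_; _∪_; ∣_∣; ⋃; ⊤)
  renaming (_∈_ to _∈ₛ_; _∉_ to _∉ₛ_)
open import Data.List using (List; []; _∷_; _++_)
open import Data.List.Membership.Propositional using () renaming (_∈_ to _∈ₗ_)
open import Data.List.Relation.Unary.Unique.Propositional using (Unique)
open import Data.Maybe using (Maybe; just; nothing)
open import Data.Product using (Σ; ∃; _×_; _,_)
open import Data.Sum using (_⊎_)
open import Data.Empty using (⊥)
open import Relation.Nullary using (¬_)
open import Relation.Nullary.Decidable using (⌊_⌋)
open import Relation.Binary.PropositionalEquality using (_≡_; _≢_)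

-- A set of rooted triplets R on V is given by its characteristic
-- function:  R a b c ≡ true  iff the triplet ab|c belongs to R.
-- (ab|c and ba|c denote the same triplet, which density enforces.)

TripletSet : ℕ → Set
TripletSet n = Fin n → Fin n → Fin n → Bool

Distinct3 : ∀ {n} → Fin n → Fin n → Fin n → Set
Distinct3 a b c = a ≢ b × a ≢ c × b ≢ c

ExactlyOne : Bool → Bool → Bool → Set
ExactlyOne x y z =
  (x ∨ y ∨ z) ≡ true × (x ∧ y) ≡ false × (x ∧ z) ≡ false × (y ∧ z) ≡ false

Dense : ∀ {n} → TripletSet n → Set
Dense {n} R =
  (∀ a b c → R a b c ≡ true → Distinct3 a b c) ×
  (∀ a b c → R a b c ≡ R b a c) ×
  (∀ a b c → Distinct3 a b c → ExactlyOne (R a b c) (R a c b) (R b c a))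

data Tree (n : ℕ) : Set where
  leaf : Fin n → Tree n
  node : Tree n → Tree n → Tree n

leaves : ∀ {n} → Tree n → List (Fin n)
leaves (leaf x)   = x ∷ []
leaves (node l r) = leaves l ++ leaves r

TreeOver : ∀ {n} → Subset n → Tree n → Set
TreeOver {n} S T =
  Unique (leaves T) × (∀ (x : Fin n) → (x ∈ₛ S → x ∈ₗ leaves T) × (x ∈ₗ leaves T → x ∈ₛ S))

-- Subtree spanning the leaves satisfying p (a Boolean predicate),
-- with unary vertices suppressed (i.e. up to homeomorphism).
restrict : ∀ {n} → (Fin n → Bool) → Tree n → Maybe (Tree n)
restrict p (leaf x) = if p x then just (leaf x) else nothing
restrict p (node l r) with restrict p l | restrict p r
... | just l' | just r' = just (node l' r')
... | just l' | nothing = just l'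
... | nothing | just r' = just r'
... | nothing | nothing = nothing

data _≅_ {n} : Tree n → Tree n → Set where
  leaf≅ : ∀ x → leaf x ≅ leaf x
  node≅ : ∀ {l r l' r'} → l ≅ l' → r ≅ r' → node l r ≅ node l' r'
  swap≅ : ∀ {l r l' r'} → l ≅ r' → r ≅ l' → node l r ≅ node l' r'

tripletTree : ∀ {n} → Fin n → Fin n → Fin n → Tree n
tripletTree a b c = node (node (leaf a) (leaf b)) (leaf c)

eqb : ∀ {n} → Fin n → Fin n → Bool
eqb x y = ⌊ x ≟ y ⌋

in3 : ∀ {n} → Fin n → Fin n → Fin n → Fin n → Bool
in3 a b c x = eqb x a ∨ eqb x b ∨ eqb x c

Consistent : ∀ {n} → Tree n → Fin n → Fin n → Fin n → Set
Consistent T a b c =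
  Σ _ λ T' → restrict (in3 a b c) T ≡ just T' × T' ≅ tripletTree a b c

IsConflict : ∀ {n} → TripletSet n → Subset n → Set
IsConflict {n} R C =
  ∣ C ∣ ≡ 4 ×
  ¬ (Σ (Tree n) λ T → TreeOver C T ×
       (∀ a b c → a ∈ₛ C → b ∈ₛ C → c ∈ₛ C → R a b c ≡ true → Consistent T a b c))

replaceTriplet : ∀ {n} → TripletSet n → Fin n → Fin n → Fin n → TripletSet n
replaceTriplet R x y z u v w =
  if in3 x y z u ∧ in3 x y z v ∧ in3 x y z w ∧
     not (eqb u v) ∧ not (eqb u w) ∧ not (eqb v w)
  then ((eqb u x ∧ eqb v y) ∨ (eqb u y ∧ eqb v x)) ∧ eqb w z
  else R u v w

Seed : ∀ {n} → TripletSet n → Subset n → Fin n → Set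
Seed R C a =
  a ∈ₛ C ×
  (∀ x y z → Distinct3 x y z → x ∈ₛ C → y ∈ₛ C → z ∈ₛ C →
     x ≢ a → y ≢ a → z ≢ a → IsConflict (replaceTriplet R x y z) C)

CanAppend : ∀ {n} → TripletSet n → Subset n → Subset n → Set
CanAppend R U C =
  ∣ C ∩ U ∣ ≤ 2 ⊎
  (Σ _ λ a → a ∈ₛ C × a ∉ₛ U × (∀ x → x ∈ₛ C → x ∉ₛ U → x ≡ a) × Seed R C a)

ValidFrom : ∀ {n} → TripletSet n → Subset n → List (Subset n) → Set
ValidFrom R U []       = Data.Unit.⊤ where import Data.Unit
ValidFrom R U (C ∷ Cs) = IsConflict R C × CanAppend R U C × ValidFrom R (U ∪ C) Cs

ConflictPacking : ∀ {n} → TripletSet n → List (Subset n) → Set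
ConflictPacking {n} R Cs =
  ValidFrom R Data.Fin.Subset.⊥ Cs ×
  (∀ C → IsConflict R C → ¬ CanAppend R (⋃ Cs) C)

-- Let U = V(𝒞). Maximality of the packing means that no 4-set Q ⊄ U is a conflict, even for the
-- triplets of R not inside U ("off U"): if |Q ∩ U| ≤ 2, Q could be appended outright; otherwise Q
-- has a single leaf e ∉ U, and e is a seed because replacing the triplet on Q ∖ {e} ⊆ U changes
-- nothing off U. So every quartet not inside U has a tree displaying its triplets off U, which gives
-- the inference rules ab|c, ac|d ⊢ ab|d and ab|c, ac|d ⊢ bc|d for triplets off U.
-- With these rules a tree displaying every triplet off U is built top-down, as in Aho et al.'s
-- BUILD: pick a leaf w ∉ U (if there is none, any split will do) and put w, together with every b
-- such that wb|v for some v, on one side of the root. The rules show that no triplet off U is cut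
-- the wrong way, and the other side is nonempty: it contains every m ≠ w that is maximal for the
-- order m ≺ v :⇔ wm|v, which is transitive by the first rule.

module Submission where

open import Defs
open import Data.Bool using (Bool; true; false; _∧_)
open import Data.Bool.Properties using () renaming (_≟_ to _≟ᵇ_)
open import Data.Empty using (⊥; ⊥-elim)
open import Data.Fin using (Fin; zero; suc; _≟_)
open import Data.Fin.Subset using (Subset; inside; outside; ⁅_⁆; _∪_; _∩_; _-_; ∣_∣; _⊆_; ⋃; ⊤)
  renaming (_∈_ to _∈ₛ_; _∉_ to _∉ₛ_)
open import Data.Fin.Subset.Properties
  using (_∈?_; ∈⊤; ∪-identityˡ; drop-not-there; x∈p∪q⁺; x∈p∪q⁻; x∈p∩q⁻; x∈⁅x⁆; x∈⁅y⁆⇒x≡y; x≢y⇒x∉⁅y⁆;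
         ∣⁅x⁆∣≡1; p⊆q⇒∣p∣≤∣q∣; x∈p∧x≢y⇒x∈p-y; x∈p⇒∣p-x∣<∣p∣)
open import Data.List using (List; []; _∷_; _++_; filter; length)
open import Data.List.Membership.Propositional using (_∈_; find; lose)
open import Data.List.Membership.Propositional.Properties
  using (∈-++⁺ˡ; ∈-++⁺ʳ; ∈-++⁻; ∈-filter⁺; ∈-filter⁻; ∈-allFin)
open import Data.List.Properties using (filter-notAll; filter-some)
open import Data.List.Relation.Binary.Disjoint.Propositional using (Disjoint)
open import Data.List.Relation.Unary.All as All using (All; all?)
open import Data.List.Relation.Unary.All.Properties using (++⁻ˡ; ++⁻ʳ; ¬All⇒Any¬)
open import Data.List.Relation.Unary.AllPairs using ([]; _∷_)
open import Data.List.Relation.Unary.Any as Any using (Any; here; there; any?)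
open import Data.List.Relation.Unary.Unique.Propositional using (Unique)
open import Data.List.Relation.Unary.Unique.Propositional.Properties
  using (++⁺; filter⁺; Unique[x∷xs]⇒x∉xs; allFin⁺)
open import Data.Maybe using (just; nothing)
open import Data.Maybe.Properties using (just-injective)
open import Data.Nat using (ℕ; suc; _+_; _≤_; _<_; _≤?_; z≤n; s≤s)
open import Data.Nat.Induction using (<-wellFounded)
open import Data.Nat.Properties using (+-cancelˡ-≤; module ≤-Reasoning)
open import Data.Product using (Σ; ∃; _×_; _,_; proj₁; proj₂; map₁; uncurry)
open import Data.Sum as Sum using (_⊎_; inj₁; inj₂; [_,_]′; fromInj₁; fromInj₂)
import Data.Vec.Base as Vec
open import Function using (_∘_; id)
import Induction.WellFounded as WF
open import Level using (0ℓ)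
open import Relation.Binary using (Rel; Decidable; Transitive; Irreflexive)
import Relation.Binary.Construct.On as On
open import Relation.Binary.PropositionalEquality
  using (_≡_; _≢_; ≢-sym; refl; sym; trans; cong; cong₂; subst; subst₂; module ≡-Reasoning)
open import Relation.Nullary using (¬_; ¬?; yes; no)
open import Relation.Nullary.Decidable using (decidable-stable; toSum; _⊎-dec_; _×-dec_)
open import Relation.Unary using (Pred; ∁) renaming (Decidable to Decidable₁)
open import Relation.Unary.Properties using (∁?)

module _ {a} {A : Set a} where

  Unique-++⁻ : ∀ xs {ys : List A} → Unique (xs ++ ys) → Unique xs × Unique ys × Disjoint xs ys
  Unique-++⁻ []       u        = [] , u , λ ()
  Unique-++⁻ (x ∷ xs) (x∉ ∷ u) with Unique-++⁻ xs u
  ... | uxs , uys , disjoint =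
    ++⁻ˡ xs x∉ ∷ uxs , uys ,
    λ { (here refl , x∈ys) → All.lookup (++⁻ʳ xs x∉) x∈ys refl
      ; (there v∈xs , v∈ys) → disjoint (v∈xs , v∈ys) }

module _ {a ℓ} {A : Set a} {_≺_ : Rel A ℓ} (_≺?_ : Decidable _≺_)
         (≺-trans : Transitive _≺_) (≺-irrefl : Irreflexive _≡_ _≺_) where

  ∃-maximal : ∀ {xs z} → z ∈ xs → ∃ λ m → m ∈ xs × ∀ {y} → y ∈ xs → ¬ m ≺ y
  ∃-maximal {x ∷ []}     _ = x , here refl , λ { (here refl) → ≺-irrefl refl }
  ∃-maximal {x ∷ y ∷ ys} _ with ∃-maximal {y ∷ ys} (here refl)
  ... | m , m∈ , m-max with m ≺? x
  ...   | yes m≺x = x , here refl ,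
                    λ { (here refl) → ≺-irrefl refl ; (there y∈) x≺y → m-max y∈ (≺-trans m≺x x≺y) }
  ...   | no  m⊀x = m , there m∈ , λ { (here refl) → m⊀x ; (there y∈) → m-max y∈ }

-- Leaf sets, clades and consistency

module _ {n : ℕ} where

  in3-true : ∀ {a b c x : Fin n} → x ≡ a ⊎ x ≡ b ⊎ x ≡ c → in3 a b c x ≡ true
  in3-true {a} {b} {c} {x} x∈abc with x ≟ a | x ≟ b | x ≟ c
  ... | yes _  | _      | _      = refl
  ... | no _   | yes _  | _      = refl
  ... | no _   | no _   | yes _  = refl
  ... | no x≢a | no x≢b | no x≢c = ⊥-elim ([ x≢a , [ x≢b , x≢c ]′ ]′ x∈abc)

  in3-true⁻ : ∀ {a b c x : Fin n} → in3 a b c x ≡ true → x ≡ a ⊎ x ≡ b ⊎ x ≡ c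
  in3-true⁻ {a} {b} {c} {x} with x ≟ a | x ≟ b | x ≟ c
  ... | yes x≡a | _       | _       = λ _ → inj₁ x≡a
  ... | no _    | yes x≡b | _       = λ _ → inj₂ (inj₁ x≡b)
  ... | no _    | no _    | yes x≡c = λ _ → inj₂ (inj₂ x≡c)
  ... | no _    | no _    | no _    = λ ()

  in3-only₂ : ∀ {a b c x : Fin n} → x ≢ c → in3 a b c x ≡ true → x ≡ a ⊎ x ≡ b
  in3-only₂ {a} {b} {c} {x} x≢c px =
    [ inj₁ , [ inj₂ , ⊥-elim ∘ x≢c ]′ ]′ (in3-true⁻ {a} {b} {c} {x} px)

  in3-only₁ : ∀ {a b c x : Fin n} → x ≢ a → x ≢ b → in3 a b c x ≡ true → x ≡ c
  in3-only₁ {a} {b} {c} {x} x≢a x≢b px =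
    [ ⊥-elim ∘ x≢a , [ ⊥-elim ∘ x≢b , id ]′ ]′ (in3-true⁻ {a} {b} {c} {x} px)

  infix 4 _∈ᵀ_ _∉ᵀ_ _⊑_

  _∈ᵀ_ _∉ᵀ_ : Fin n → Tree n → Set
  x ∈ᵀ t = x ∈ leaves t
  x ∉ᵀ t = ¬ x ∈ᵀ t

  in3-absent : ∀ {t a b c} → a ∉ᵀ t → b ∉ᵀ t → c ∉ᵀ t → ∀ {x} → x ∈ᵀ t → in3 a b c x ≡ false
  in3-absent {a = a} {b} {c} a∉ b∉ c∉ {x} x∈ with in3 a b c x in e
  ... | false = refl
  ... | true  = ⊥-elim ([ (λ { refl → a∉ x∈ }) , [ (λ { refl → b∉ x∈ }) , (λ { refl → c∉ x∈ }) ]′ ]′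
                          (in3-true⁻ {a} {b} {c} {x} e))

  ∃-leaf : ∀ t → ∃ (_∈ᵀ t)
  ∃-leaf (leaf x)   = x , here refl
  ∃-leaf (node l r) with ∃-leaf l
  ... | x , x∈l = x , ∈-++⁺ˡ x∈l

  uniqueˡ : ∀ {l r : Tree n} → Unique (leaves (node l r)) → Unique (leaves l)
  uniqueˡ {l} u = proj₁ (Unique-++⁻ (leaves l) u)

  uniqueʳ : ∀ {l r : Tree n} → Unique (leaves (node l r)) → Unique (leaves r)
  uniqueʳ {l} u = proj₁ (proj₂ (Unique-++⁻ (leaves l) u))

  disjoint : ∀ {l r : Tree n} {x} → Unique (leaves (node l r)) → x ∈ᵀ l → x ∉ᵀ r
  disjoint {l} u x∈l x∈r = proj₂ (proj₂ (Unique-++⁻ (leaves l) u)) (x∈l , x∈r)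

  data _⊑_ : Tree n → Tree n → Set where
    ⊑-refl  : ∀ {t} → t ⊑ t
    ⊑-nodeˡ : ∀ {s l r} → s ⊑ l → s ⊑ node l r
    ⊑-nodeʳ : ∀ {s l r} → s ⊑ r → s ⊑ node l r

  ⊑-∈ : ∀ {s t x} → s ⊑ t → x ∈ᵀ s → x ∈ᵀ t
  ⊑-∈ ⊑-refl                  x∈s = x∈s
  ⊑-∈ (⊑-nodeˡ s⊑l)           x∈s = ∈-++⁺ˡ (⊑-∈ s⊑l x∈s)
  ⊑-∈ (⊑-nodeʳ {l = l} s⊑r)   x∈s = ∈-++⁺ʳ (leaves l) (⊑-∈ s⊑r x∈s)

  ⊑-laminar : ∀ {t s₁ s₂ x} → Unique (leaves t) → s₁ ⊑ t → s₂ ⊑ t →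
              x ∈ᵀ s₁ → x ∈ᵀ s₂ → s₁ ⊑ s₂ ⊎ s₂ ⊑ s₁
  ⊑-laminar u ⊑-refl       s₂⊑t         _ _ = inj₂ s₂⊑t
  ⊑-laminar u (⊑-nodeˡ s₁⊑l) ⊑-refl     _ _ = inj₁ (⊑-nodeˡ s₁⊑l)
  ⊑-laminar u (⊑-nodeʳ s₁⊑r) ⊑-refl     _ _ = inj₁ (⊑-nodeʳ s₁⊑r)
  ⊑-laminar {node l r} u (⊑-nodeˡ s₁⊑l) (⊑-nodeˡ s₂⊑l) x₁ x₂ =
    ⊑-laminar (uniqueˡ {l} {r} u) s₁⊑l s₂⊑l x₁ x₂
  ⊑-laminar {node l r} u (⊑-nodeʳ s₁⊑r) (⊑-nodeʳ s₂⊑r) x₁ x₂ =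
    ⊑-laminar (uniqueʳ {l} {r} u) s₁⊑r s₂⊑r x₁ x₂
  ⊑-laminar {node l r} u (⊑-nodeˡ s₁⊑l) (⊑-nodeʳ s₂⊑r) x₁ x₂ =
    ⊥-elim (disjoint {l} {r} u (⊑-∈ s₁⊑l x₁) (⊑-∈ s₂⊑r x₂))
  ⊑-laminar {node l r} u (⊑-nodeʳ s₁⊑r) (⊑-nodeˡ s₂⊑l) x₁ x₂ =
    ⊥-elim (disjoint {l} {r} u (⊑-∈ s₂⊑l x₂) (⊑-∈ s₁⊑r x₁))

  Separates : Tree n → Fin n → Fin n → Fin n → Set
  Separates t a b c = ∃ λ s → s ⊑ t × a ∈ᵀ s × b ∈ᵀ s × c ∉ᵀ s

  separates-swap : ∀ {t a b c} → Separates t a b c → Separates t b a c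
  separates-swap (s , s⊑t , a∈s , b∈s , c∉s) = s , s⊑t , b∈s , a∈s , c∉s

  separates-trans : ∀ {t a b c d} → Unique (leaves t) → Separates t a b c → Separates t a c d →
                    Separates t a b d × Separates t b c d
  separates-trans u (s₁ , s₁⊑t , a∈s₁ , b∈s₁ , c∉s₁) (s₂ , s₂⊑t , a∈s₂ , c∈s₂ , d∉s₂)
    with ⊑-laminar u s₁⊑t s₂⊑t a∈s₁ a∈s₂
  ... | inj₁ s₁⊑s₂ = (s₁ , s₁⊑t , a∈s₁ , b∈s₁ , d∉s₂ ∘ ⊑-∈ s₁⊑s₂) ,
                     (s₂ , s₂⊑t , ⊑-∈ s₁⊑s₂ b∈s₁ , c∈s₂ , d∉s₂)
  ... | inj₂ s₂⊑s₁ = ⊥-elim (c∉s₁ (⊑-∈ s₂⊑s₁ c∈s₂))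

  separates-exclusive : ∀ {t a b c} → Unique (leaves t) → Separates t a b c → Separates t a c b → ⊥
  separates-exclusive u (s₁ , s₁⊑t , a∈s₁ , b∈s₁ , c∉s₁) (s₂ , s₂⊑t , a∈s₂ , c∈s₂ , b∉s₂)
    with ⊑-laminar u s₁⊑t s₂⊑t a∈s₁ a∈s₂
  ... | inj₁ s₁⊑s₂ = b∉s₂ (⊑-∈ s₁⊑s₂ b∈s₁)
  ... | inj₂ s₂⊑s₁ = c∉s₁ (⊑-∈ s₂⊑s₁ c∈s₂)

  ≅-∈ : ∀ {t t' x} → t ≅ t' → x ∈ᵀ t' → x ∈ᵀ t
  ≅-∈ (leaf≅ _) x∈ = x∈
  ≅-∈ (node≅ {l} {r} {l'} l≅l' r≅r') x∈ with ∈-++⁻ (leaves l') x∈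
  ... | inj₁ x∈l' = ∈-++⁺ˡ (≅-∈ l≅l' x∈l')
  ... | inj₂ x∈r' = ∈-++⁺ʳ (leaves l) (≅-∈ r≅r' x∈r')
  ≅-∈ (swap≅ {l} {r} {l'} l≅r' r≅l') x∈ with ∈-++⁻ (leaves l') x∈
  ... | inj₁ x∈l' = ∈-++⁺ʳ (leaves l) (≅-∈ r≅l' x∈l')
  ... | inj₂ x∈r' = ∈-++⁺ˡ (≅-∈ l≅r' x∈r')

  single-leaf : ∀ {t c} → Unique (leaves t) → (∀ {x} → x ∈ᵀ t → x ≡ c) → t ≡ leaf c
  single-leaf {leaf y}   _ only = cong leaf (only (here refl))
  single-leaf {node l r} u only with ∃-leaf l | ∃-leaf r
  ... | x , x∈l | y , y∈r = ⊥-elim (disjoint {l} {r} u x∈l (subst (_∈ᵀ r) y≡x y∈r))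
    where y≡x = trans (only (∈-++⁺ʳ (leaves l) y∈r)) (sym (only (∈-++⁺ˡ x∈l)))

  cherry : ∀ {t a b} → Unique (leaves t) → a ≢ b → a ∈ᵀ t → b ∈ᵀ t →
           (∀ {x} → x ∈ᵀ t → x ≡ a ⊎ x ≡ b) → t ≅ node (leaf a) (leaf b)
  cherry {leaf y} _ a≢b (here refl) (here refl) _ = ⊥-elim (a≢b refl)
  cherry {node l r} {a} {b} u a≢b a∈ b∈ only = sides (∈-++⁻ (leaves l) a∈) (∈-++⁻ (leaves l) b∈)
    where
      ≢-across : ∀ {x y} → x ∈ᵀ l → y ∈ᵀ r → x ≢ y
      ≢-across x∈l y∈r refl = disjoint {l} {r} u x∈l y∈r

      ≢-across⁻ : ∀ {x y} → x ∈ᵀ l → y ∈ᵀ r → y ≢ x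
      ≢-across⁻ x∈l y∈r = ≢-sym (≢-across x∈l y∈r)

      onlyˡ : ∀ {x} → x ∈ᵀ l → x ≡ a ⊎ x ≡ b
      onlyˡ = only ∘ ∈-++⁺ˡ

      onlyʳ : ∀ {x} → x ∈ᵀ r → x ≡ a ⊎ x ≡ b
      onlyʳ = only ∘ ∈-++⁺ʳ (leaves l)

      sides : a ∈ᵀ l ⊎ a ∈ᵀ r → b ∈ᵀ l ⊎ b ∈ᵀ r → node l r ≅ node (leaf a) (leaf b)
      sides (inj₁ a∈l) (inj₂ b∈r) =
        subst₂ (λ l' r' → node l' r' ≅ node (leaf a) (leaf b))
          (sym (single-leaf (uniqueˡ {l} {r} u) λ x∈l → fromInj₁ (⊥-elim ∘ ≢-across x∈l b∈r) (onlyˡ x∈l)))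
          (sym (single-leaf (uniqueʳ {l} {r} u) λ x∈r → fromInj₂ (⊥-elim ∘ ≢-across⁻ a∈l x∈r) (onlyʳ x∈r)))
          (node≅ (leaf≅ a) (leaf≅ b))
      sides (inj₂ a∈r) (inj₁ b∈l) =
        subst₂ (λ l' r' → node l' r' ≅ node (leaf a) (leaf b))
          (sym (single-leaf (uniqueˡ {l} {r} u) λ x∈l → fromInj₂ (⊥-elim ∘ ≢-across x∈l a∈r) (onlyˡ x∈l)))
          (sym (single-leaf (uniqueʳ {l} {r} u) λ x∈r → fromInj₁ (⊥-elim ∘ ≢-across⁻ b∈l x∈r) (onlyʳ x∈r)))
          (swap≅ (leaf≅ b) (leaf≅ a))
      sides (inj₁ a∈l) (inj₁ b∈l) with ∃-leaf r
      ... | z , z∈r = ⊥-elim ([ ≢-across⁻ a∈l z∈r , ≢-across⁻ b∈l z∈r ]′ (onlyʳ z∈r))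
      sides (inj₂ a∈r) (inj₂ b∈r) with ∃-leaf l
      ... | z , z∈l = ⊥-elim ([ ≢-across z∈l a∈r , ≢-across z∈l b∈r ]′ (onlyˡ z∈l))

  module _ (p : Fin n → Bool) where

    restrict-∈⁻ : ∀ t {t' x} → restrict p t ≡ just t' → x ∈ᵀ t' → x ∈ᵀ t × p x ≡ true
    restrict-∈⁻ (leaf y) eq x∈ with p y in py
    restrict-∈⁻ (leaf y) refl (here refl) | true = here refl , py
    restrict-∈⁻ (node l r) eq x∈ with restrict p l in el | restrict p r in er
    restrict-∈⁻ (node l r) refl x∈ | just l' | just r' with ∈-++⁻ (leaves l') x∈
    ... | inj₁ x∈l' = map₁ ∈-++⁺ˡ (restrict-∈⁻ l el x∈l')
    ... | inj₂ x∈r' = map₁ (∈-++⁺ʳ (leaves l)) (restrict-∈⁻ r er x∈r')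
    restrict-∈⁻ (node l r) refl x∈ | just l' | nothing = map₁ ∈-++⁺ˡ (restrict-∈⁻ l el x∈)
    restrict-∈⁻ (node l r) refl x∈ | nothing | just r' = map₁ (∈-++⁺ʳ (leaves l)) (restrict-∈⁻ r er x∈)

    restrict-∈⁺ : ∀ t {x} → x ∈ᵀ t → p x ≡ true → ∃ λ t' → restrict p t ≡ just t' × x ∈ᵀ t'
    restrict-∈⁺ (leaf y) (here refl) px rewrite px = leaf y , refl , here refl
    restrict-∈⁺ (node l r) x∈ px with ∈-++⁻ (leaves l) x∈
    ... | inj₁ x∈l with restrict-∈⁺ l x∈l px
    ...   | l' , el , x∈l' rewrite el with restrict p r
    ...     | just r' = node l' r' , refl , ∈-++⁺ˡ x∈l'
    ...     | nothing = l' , refl , x∈l'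
    restrict-∈⁺ (node l r) x∈ px | inj₂ x∈r with restrict-∈⁺ r x∈r px
    ...   | r' , er , x∈r' rewrite er with restrict p l
    ...     | just l' = node l' r' , refl , ∈-++⁺ʳ (leaves l') x∈r'
    ...     | nothing = r' , refl , x∈r'

    restrict-unique : ∀ t {t'} → Unique (leaves t) → restrict p t ≡ just t' → Unique (leaves t')
    restrict-unique (leaf y) u eq with p y
    restrict-unique (leaf y) u refl | true = u
    restrict-unique (node l r) u eq with restrict p l in el | restrict p r in er
    restrict-unique (node l r) u refl | just l' | just r' =
      ++⁺ (restrict-unique l (uniqueˡ {l} {r} u) el) (restrict-unique r (uniqueʳ {l} {r} u) er)
          λ (x∈l' , x∈r') →
            disjoint {l} {r} u (proj₁ (restrict-∈⁻ l el x∈l')) (proj₁ (restrict-∈⁻ r er x∈r'))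
    restrict-unique (node l r) u refl | just l' | nothing = restrict-unique l (uniqueˡ {l} {r} u) el
    restrict-unique (node l r) u refl | nothing | just r' = restrict-unique r (uniqueʳ {l} {r} u) er

    restrict-nothing : ∀ t → (∀ {x} → x ∈ᵀ t → p x ≡ false) → restrict p t ≡ nothing
    restrict-nothing (leaf y) none rewrite none (here refl) = refl
    restrict-nothing (node l r) none
      rewrite restrict-nothing l (none ∘ ∈-++⁺ˡ) | restrict-nothing r (none ∘ ∈-++⁺ʳ (leaves l)) = refl

    restrict-single : ∀ t {c} → Unique (leaves t) → c ∈ᵀ t → p c ≡ true →
                      (∀ {x} → x ∈ᵀ t → p x ≡ true → x ≡ c) → restrict p t ≡ just (leaf c)
    restrict-single t u c∈ pc only with restrict-∈⁺ t c∈ pc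
    ... | t' , e , _ =
      trans e (cong just (single-leaf (restrict-unique t u e) (uncurry only ∘ restrict-∈⁻ t e)))

    restrict-cherry : ∀ t {a b} → Unique (leaves t) → a ≢ b → a ∈ᵀ t → b ∈ᵀ t → p a ≡ true → p b ≡ true →
                      (∀ {x} → x ∈ᵀ t → p x ≡ true → x ≡ a ⊎ x ≡ b) →
                      ∃ λ t' → restrict p t ≡ just t' × t' ≅ node (leaf a) (leaf b)
    restrict-cherry t u a≢b a∈ b∈ pa pb only with restrict-∈⁺ t a∈ pa | restrict-∈⁺ t b∈ pb
    ... | t' , e , a∈t' | t'' , e' , b∈t'' =
      t' , e , cherry (restrict-unique t u e) a≢b a∈t' (subst (_ ∈ᵀ_) t''≡t' b∈t'')
                      (uncurry only ∘ restrict-∈⁻ t e)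
      where t''≡t' = just-injective (trans (sym e') e)

    restrict-≅-∈⁻ : ∀ t {t' t'' x} → restrict p t ≡ just t' → t' ≅ t'' → x ∈ᵀ t'' → x ∈ᵀ t
    restrict-≅-∈⁻ t e t'≅t'' = proj₁ ∘ restrict-∈⁻ t e ∘ ≅-∈ t'≅t''

  consistent⇒separates : ∀ t {a b c} → Unique (leaves t) → Consistent t a b c → Separates t a b c
  consistent⇒separates (leaf y) {a} {b} {c} u (_ , e , t'≅abc) with in3 a b c y
  consistent⇒separates (leaf y) u (_ , refl , ()) | true
  consistent⇒separates (node l r) {a} {b} {c} u (t' , e , t'≅abc)
    with restrict (in3 a b c) l in el | restrict (in3 a b c) r in er
  consistent⇒separates (node l r) u (_ , refl , node≅ l'≅ab r'≅c) | just _ | just _ =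
    l , ⊑-nodeˡ ⊑-refl ,
    restrict-≅-∈⁻ _ l el l'≅ab (here refl) , restrict-≅-∈⁻ _ l el l'≅ab (there (here refl)) ,
    λ c∈l → disjoint {l} {r} u c∈l (restrict-≅-∈⁻ _ r er r'≅c (here refl))
  consistent⇒separates (node l r) u (_ , refl , swap≅ l'≅c r'≅ab) | just _ | just _ =
    r , ⊑-nodeʳ ⊑-refl ,
    restrict-≅-∈⁻ _ r er r'≅ab (here refl) , restrict-≅-∈⁻ _ r er r'≅ab (there (here refl)) ,
    disjoint {l} {r} u (restrict-≅-∈⁻ _ l el l'≅c (here refl))
  consistent⇒separates (node l r) u (t' , refl , t'≅abc) | just _ | nothing
    with consistent⇒separates l (uniqueˡ {l} {r} u) (t' , el , t'≅abc)
  ... | s , s⊑l , sep = s , ⊑-nodeˡ s⊑l , sep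
  consistent⇒separates (node l r) u (t' , refl , t'≅abc) | nothing | just _
    with consistent⇒separates r (uniqueʳ {l} {r} u) (t' , er , t'≅abc)
  ... | s , s⊑r , sep = s , ⊑-nodeʳ s⊑r , sep

  consistent-nodeˡ : ∀ l r {a b c} → Consistent l a b c → a ∉ᵀ r → b ∉ᵀ r → c ∉ᵀ r →
                     Consistent (node l r) a b c
  consistent-nodeˡ l r {a} {b} {c} (t' , e , t'≅abc) a∉r b∉r c∉r
    rewrite e | restrict-nothing (in3 a b c) r (in3-absent {r} {a} {b} {c} a∉r b∉r c∉r) = t' , refl , t'≅abc

  consistent-nodeʳ : ∀ l r {a b c} → Consistent r a b c → a ∉ᵀ l → b ∉ᵀ l → c ∉ᵀ l →
                     Consistent (node l r) a b c
  consistent-nodeʳ l r {a} {b} {c} (t' , e , t'≅abc) a∉l b∉l c∉l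
    rewrite e | restrict-nothing (in3 a b c) l (in3-absent {l} {a} {b} {c} a∉l b∉l c∉l) = t' , refl , t'≅abc

  consistent-split : ∀ l r {a b c} → Unique (leaves (node l r)) → a ≢ b →
                     a ∈ᵀ l → b ∈ᵀ l → c ∈ᵀ r → Consistent (node l r) a b c
  consistent-split l r {a} {b} {c} u a≢b a∈l b∈l c∈r
    with restrict-cherry (in3 a b c) l (uniqueˡ {l} {r} u) a≢b a∈l b∈l
           (in3-true {a} {b} {c} (inj₁ refl)) (in3-true {a} {b} {c} (inj₂ (inj₁ refl)))
           (λ x∈l → in3-only₂ {a} {b} {c} (λ { refl → disjoint {l} {r} u x∈l c∈r }))
  ... | l' , el , l'≅ab
    rewrite el
          | restrict-single (in3 a b c) r (uniqueʳ {l} {r} u) c∈r (in3-true {a} {b} {c} (inj₂ (inj₂ refl)))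
                   (λ x∈r → in3-only₁ {a} {b} {c} (λ { refl → disjoint {l} {r} u a∈l x∈r })
                                                  (λ { refl → disjoint {l} {r} u b∈l x∈r }))
    = node l' (leaf c) , refl , node≅ l'≅ab (leaf≅ c)

  consistent-splitʳ : ∀ l r {a b c} → Unique (leaves (node l r)) → a ≢ b →
                      a ∈ᵀ r → b ∈ᵀ r → c ∈ᵀ l → Consistent (node l r) a b c
  consistent-splitʳ l r {a} {b} {c} u a≢b a∈r b∈r c∈l
    with restrict-cherry (in3 a b c) r (uniqueʳ {l} {r} u) a≢b a∈r b∈r
           (in3-true {a} {b} {c} (inj₁ refl)) (in3-true {a} {b} {c} (inj₂ (inj₁ refl)))
           (λ x∈r → in3-only₂ {a} {b} {c} (λ { refl → disjoint {l} {r} u c∈l x∈r }))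
  ... | r' , er , r'≅ab
    rewrite er
          | restrict-single (in3 a b c) l (uniqueˡ {l} {r} u) c∈l (in3-true {a} {b} {c} (inj₂ (inj₂ refl)))
                   (λ x∈l → in3-only₁ {a} {b} {c} (λ { refl → disjoint {l} {r} u x∈l a∈r })
                                                  (λ { refl → disjoint {l} {r} u x∈l b∈r }))
    = node (leaf c) r' , refl , swap≅ (leaf≅ c) r'≅ab

-- Cardinalities of small subsets

∣⁅x⁆∪p∣≡1+∣p∣ : ∀ {n} {x : Fin n} p → x ∉ₛ p → ∣ ⁅ x ⁆ ∪ p ∣ ≡ suc ∣ p ∣
∣⁅x⁆∪p∣≡1+∣p∣ {x = zero}  (outside Vec.∷ p) _   = cong (suc ∘ ∣_∣) (∪-identityˡ p)
∣⁅x⁆∪p∣≡1+∣p∣ {x = zero}  (inside  Vec.∷ p) x∉p = ⊥-elim (x∉p Vec.here)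
∣⁅x⁆∪p∣≡1+∣p∣ {x = suc x} (outside Vec.∷ p) x∉p = ∣⁅x⁆∪p∣≡1+∣p∣ p (drop-not-there x∉p)
∣⁅x⁆∪p∣≡1+∣p∣ {x = suc x} (inside  Vec.∷ p) x∉p = cong suc (∣⁅x⁆∪p∣≡1+∣p∣ p (drop-not-there x∉p))

module _ {n : ℕ} where

  x∈⁅y⁆∪p⁺ : ∀ {x y : Fin n} {p} → x ≡ y ⊎ x ∈ₛ p → x ∈ₛ ⁅ y ⁆ ∪ p
  x∈⁅y⁆∪p⁺ = x∈p∪q⁺ ∘ Sum.map₁ (λ { refl → x∈⁅x⁆ _ })

  x∉⁅y⁆∪p : ∀ {x y : Fin n} {p} → x ≢ y → x ∉ₛ p → x ∉ₛ ⁅ y ⁆ ∪ p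
  x∉⁅y⁆∪p x≢y x∉p x∈ = [ x≢y ∘ x∈⁅y⁆⇒x≡y _ , x∉p ]′ (x∈p∪q⁻ _ _ x∈)

  quartet : Fin n → Fin n → Fin n → Fin n → Subset n
  quartet a b c d = ⁅ a ⁆ ∪ ⁅ b ⁆ ∪ ⁅ c ⁆ ∪ ⁅ d ⁆

  ∈-quartet : ∀ {a b c d x} → x ≡ a ⊎ x ≡ b ⊎ x ≡ c ⊎ x ≡ d → x ∈ₛ quartet a b c d
  ∈-quartet = x∈⁅y⁆∪p⁺ ∘ Sum.map₂ (x∈⁅y⁆∪p⁺ ∘ Sum.map₂ (x∈⁅y⁆∪p⁺ ∘ Sum.map₂ λ { refl → x∈⁅x⁆ _ }))

  ∣quartet∣≡4 : ∀ {a b c d} → a ≢ b → a ≢ c → a ≢ d → b ≢ c → b ≢ d → c ≢ d → ∣ quartet a b c d ∣ ≡ 4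
  ∣quartet∣≡4 {a} {b} {c} {d} a≢b a≢c a≢d b≢c b≢d c≢d = begin
    ∣ quartet a b c d ∣            ≡⟨ ∣⁅x⁆∪p∣≡1+∣p∣ _ (x∉⁅y⁆∪p a≢b (x∉⁅y⁆∪p a≢c (x≢y⇒x∉⁅y⁆ a≢d))) ⟩
    1 + ∣ ⁅ b ⁆ ∪ ⁅ c ⁆ ∪ ⁅ d ⁆ ∣  ≡⟨ cong suc (∣⁅x⁆∪p∣≡1+∣p∣ _ (x∉⁅y⁆∪p b≢c (x≢y⇒x∉⁅y⁆ b≢d))) ⟩
    2 + ∣ ⁅ c ⁆ ∪ ⁅ d ⁆ ∣          ≡⟨ cong (2 +_) (∣⁅x⁆∪p∣≡1+∣p∣ _ (x≢y⇒x∉⁅y⁆ c≢d)) ⟩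
    3 + ∣ ⁅ d ⁆ ∣                  ≡⟨ cong (3 +_) (∣⁅x⁆∣≡1 d) ⟩
    4                              ∎
    where open ≡-Reasoning

  2+∣p∩q∣≤∣p∣ : ∀ {p q : Subset n} {x y} → x ∈ₛ p → y ∈ₛ p → x ≢ y → x ∉ₛ q → y ∉ₛ q → 2 + ∣ p ∩ q ∣ ≤ ∣ p ∣
  2+∣p∩q∣≤∣p∣ {p} {q} {x} {y} x∈p y∈p x≢y x∉q y∉q = begin-strict
    1 + ∣ p ∩ q ∣      ≤⟨ s≤s (p⊆q⇒∣p∣≤∣q∣ p∩q⊆p-x-y) ⟩
    1 + ∣ p - x - y ∣  ≤⟨ x∈p⇒∣p-x∣<∣p∣ (x∈p∧x≢y⇒x∈p-y y∈p (x≢y ∘ sym)) ⟩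
    ∣ p - x ∣          <⟨ x∈p⇒∣p-x∣<∣p∣ x∈p ⟩
    ∣ p ∣              ∎
    where
      open ≤-Reasoning
      p∩q⊆p-x-y : p ∩ q ⊆ p - x - y
      p∩q⊆p-x-y z∈p∩q with x∈p∩q⁻ p q z∈p∩q
      ... | z∈p , z∈q = x∈p∧x≢y⇒x∈p-y (x∈p∧x≢y⇒x∈p-y z∈p λ { refl → x∉q z∈q }) λ { refl → y∉q z∈q }

module DenseTriplets {n : ℕ} {R : TripletSet n} (dense : Dense R) where

  R-distinct : ∀ {a b c} → R a b c ≡ true → Distinct3 a b c
  R-distinct = proj₁ dense _ _ _

  R-sym : ∀ {a b c} → R a b c ≡ true → R b a c ≡ true
  R-sym {a} {b} {c} = trans (sym (proj₁ (proj₂ dense) a b c))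

  R-total : ∀ {a b c} → Distinct3 a b c → R a b c ≡ true ⊎ R a c b ≡ true ⊎ R b c a ≡ true
  R-total {a} {b} {c} abc with R a b c | R a c b | R b c a | proj₁ (proj₂ (proj₂ dense) a b c abc)
  ... | true  | _     | _     | _  = inj₁ refl
  ... | false | true  | _     | _  = inj₂ (inj₁ refl)
  ... | false | false | true  | _  = inj₂ (inj₂ refl)
  ... | false | false | false | ()

  R-exclusive : ∀ {a b c} → R a b c ≡ true → R a c b ≡ true → ⊥
  R-exclusive {a} {b} {c} r₁ r₂
    with R a b c ∧ R a c b | cong₂ _∧_ r₁ r₂ | proj₁ (proj₂ (proj₂ (proj₂ dense) a b c (R-distinct r₁)))
  ... | true  | _    | ()
  ... | false | ()   | _

module MaximalPacking {n : ℕ} {R : TripletSet n} (dense : Dense R) (U : Subset n)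
               (maximal : ∀ C → IsConflict R C → ¬ CanAppend R U C) where

  open DenseTriplets dense

  OffU : Fin n → Fin n → Fin n → Set
  OffU a b c = ¬ (a ∈ₛ U × b ∈ₛ U × c ∈ₛ U)

  DisplaysOffU : Subset n → Tree n → Set
  DisplaysOffU Q T = ∀ {u v w} → u ∈ₛ Q → v ∈ₛ Q → w ∈ₛ Q → R u v w ≡ true → OffU u v w → Consistent T u v w

  replaceTriplet-offU : ∀ {x y z u v w} → x ∈ₛ U → y ∈ₛ U → z ∈ₛ U → OffU u v w →
                        replaceTriplet R x y z u v w ≡ R u v w
  replaceTriplet-offU {x} {y} {z} {u} {v} {w} x∈U y∈U z∈U off
    with in3 x y z u in eu | in3 x y z v in ev | in3 x y z w in ew
  ... | false | _     | _     = refl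
  ... | true  | false | _     = refl
  ... | true  | true  | false = refl
  ... | true  | true  | true  = ⊥-elim (off (in-U eu , in-U ev , in-U ew))
    where
      in-U : ∀ {t} → in3 x y z t ≡ true → t ∈ₛ U
      in-U {t} e = [ (λ { refl → x∈U }) , [ (λ { refl → y∈U }) , (λ { refl → z∈U }) ]′ ]′
                     (in3-true⁻ {a = x} {y} {z} {t} e)

  conflict-offU : ∀ {Q} R' → ∣ Q ∣ ≡ 4 → ¬ (∃ λ T → TreeOver Q T × DisplaysOffU Q T) →
                  (∀ {u v w} → OffU u v w → R' u v w ≡ R u v w) → IsConflict R' Q
  conflict-offU R' ∣Q∣≡4 no-tree agrees = ∣Q∣≡4 , λ (T , over , consistent) →
    no-tree (T , over , λ u∈ v∈ w∈ r off → consistent _ _ _ u∈ v∈ w∈ (trans (agrees off) r))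

  quartet-displayable : ∀ {Q e} → ∣ Q ∣ ≡ 4 → e ∈ₛ Q → e ∉ₛ U →
                        ¬ ¬ (∃ λ T → TreeOver Q T × DisplaysOffU Q T)
  quartet-displayable {Q} {e} ∣Q∣≡4 e∈Q e∉U no-tree with ∣ Q ∩ U ∣ ≤? 2
  ... | yes small = maximal Q (conflict-offU R ∣Q∣≡4 no-tree (λ _ → refl)) (inj₁ small)
  ... | no big    = maximal Q (conflict-offU R ∣Q∣≡4 no-tree (λ _ → refl))
                      (inj₂ (e , e∈Q , e∉U , sole-outsider , e∈Q , seed))
    where
      sole-outsider : ∀ x → x ∈ₛ Q → x ∉ₛ U → x ≡ e
      sole-outsider x x∈Q x∉U with x ≟ e
      ... | yes x≡e = x≡e
      ... | no  x≢e =
        ⊥-elim (big (+-cancelˡ-≤ 2 _ _ (subst (2 + ∣ Q ∩ U ∣ ≤_) ∣Q∣≡4 (2+∣p∩q∣≤∣p∣ x∈Q e∈Q x≢e x∉U e∉U))))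

      in-U : ∀ {x} → x ∈ₛ Q → x ≢ e → x ∈ₛ U
      in-U {x} x∈Q x≢e = decidable-stable (x ∈? U) (x≢e ∘ sole-outsider x x∈Q)

      seed : ∀ x y z → Distinct3 x y z → x ∈ₛ Q → y ∈ₛ Q → z ∈ₛ Q → x ≢ e → y ≢ e → z ≢ e →
             IsConflict (replaceTriplet R x y z) Q
      seed x y z _ x∈Q y∈Q z∈Q x≢e y≢e z≢e =
        conflict-offU (replaceTriplet R x y z) ∣Q∣≡4 no-tree
          (replaceTriplet-offU (in-U x∈Q x≢e) (in-U y∈Q y≢e) (in-U z∈Q z≢e))

  separation⇒triplet : ∀ {Q T x y z} → Unique (leaves T) → DisplaysOffU Q T →
                       x ∈ₛ Q → y ∈ₛ Q → z ∈ₛ Q → Distinct3 x y z → OffU x y z →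
                       Separates T x y z → R x y z ≡ true
  separation⇒triplet {T = T} u displays x∈ y∈ z∈ xyz off xy∣z with R-total xyz
  ... | inj₁ r = r
  ... | inj₂ (inj₁ r) = ⊥-elim (separates-exclusive u xy∣z
          (consistent⇒separates T u (displays x∈ z∈ y∈ r λ (x∈U , z∈U , y∈U) → off (x∈U , y∈U , z∈U))))
  ... | inj₂ (inj₂ r) = ⊥-elim (separates-exclusive u (separates-swap xy∣z)
          (consistent⇒separates T u (displays y∈ z∈ x∈ r λ (y∈U , z∈U , x∈U) → off (x∈U , y∈U , z∈U))))

  outsider : ∀ {Q x y z} → x ∈ₛ Q → y ∈ₛ Q → z ∈ₛ Q → OffU x y z → ∃ λ e → e ∈ₛ Q × e ∉ₛ U
  outsider {x = x} {y} {z} x∈ y∈ z∈ off with x ∈? U | y ∈? U | z ∈? U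
  ... | no x∉U  | _       | _       = x , x∈ , x∉U
  ... | yes _   | no y∉U  | _       = y , y∈ , y∉U
  ... | yes _   | yes _   | no z∉U  = z , z∈ , z∉U
  ... | yes x∈U | yes y∈U | yes z∈U = ⊥-elim (off (x∈U , y∈U , z∈U))

  private
    quartet-rule : ∀ {a b c d x y z} → a ≢ b → a ≢ c → a ≢ d → b ≢ c → b ≢ d → c ≢ d →
                   x ∈ₛ quartet a b c d → y ∈ₛ quartet a b c d → z ∈ₛ quartet a b c d →
                   Distinct3 x y z → OffU x y z →
                   (∀ {T} → Unique (leaves T) → DisplaysOffU (quartet a b c d) T → Separates T x y z) →
                   R x y z ≡ true
    quartet-rule {x = x} {y} {z} a≢b a≢c a≢d b≢c b≢d c≢d x∈ y∈ z∈ xyz off separates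
      with outsider x∈ y∈ z∈ off
    ... | e , e∈ , e∉U = decidable-stable (R x y z ≟ᵇ true) λ ¬r →
      quartet-displayable (∣quartet∣≡4 a≢b a≢c a≢d b≢c b≢d c≢d) e∈ e∉U
        λ (T , (u , _) , displays) →
          ¬r (separation⇒triplet u displays x∈ y∈ z∈ xyz off (separates {T} u displays))

    ab∣c∧ac∣d⇒ : ∀ {a b c d} → R a b c ≡ true → R a c d ≡ true → b ≢ d → OffU a b c → OffU a c d →
                 (OffU a b d → R a b d ≡ true) × (OffU b c d → R b c d ≡ true)
    ab∣c∧ac∣d⇒ {a} {b} {c} {d} r₁ r₂ b≢d off₁ off₂ with R-distinct r₁ | R-distinct r₂
    ... | a≢b , a≢c , b≢c | _ , a≢d , c≢d =
      (λ off → quartet-rule a≢b a≢c a≢d b≢c b≢d c≢d a∈ b∈ d∈ (a≢b , a≢d , b≢d) off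
                 λ u displays → proj₁ (sep u displays)) ,
      (λ off → quartet-rule a≢b a≢c a≢d b≢c b≢d c≢d b∈ c∈ d∈ (b≢c , b≢d , c≢d) off
                 λ u displays → proj₂ (sep u displays))
      where
        a∈ = ∈-quartet {a = a} {b} {c} {d} (inj₁ refl)
        b∈ = ∈-quartet {a = a} {b} {c} {d} (inj₂ (inj₁ refl))
        c∈ = ∈-quartet {a = a} {b} {c} {d} (inj₂ (inj₂ (inj₁ refl)))
        d∈ = ∈-quartet {a = a} {b} {c} {d} (inj₂ (inj₂ (inj₂ refl)))
        sep : ∀ {T} → Unique (leaves T) → DisplaysOffU (quartet a b c d) T →
              Separates T a b d × Separates T b c d
        sep {T} u displays =
          separates-trans u (consistent⇒separates T u (displays a∈ b∈ c∈ r₁ off₁))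
                            (consistent⇒separates T u (displays a∈ c∈ d∈ r₂ off₂))

  ab∣c∧ac∣d⇒ab∣d : ∀ {a b c d} → R a b c ≡ true → R a c d ≡ true → b ≢ d →
                   OffU a b c → OffU a c d → OffU a b d → R a b d ≡ true
  ab∣c∧ac∣d⇒ab∣d r₁ r₂ b≢d off₁ off₂ = proj₁ (ab∣c∧ac∣d⇒ r₁ r₂ b≢d off₁ off₂)

  ab∣c∧ac∣d⇒bc∣d : ∀ {a b c d} → R a b c ≡ true → R a c d ≡ true → b ≢ d →
                   OffU a b c → OffU a c d → OffU b c d → R b c d ≡ true
  ab∣c∧ac∣d⇒bc∣d r₁ r₂ b≢d off₁ off₂ = proj₂ (ab∣c∧ac∣d⇒ r₁ r₂ b≢d off₁ off₂)

  record DisplayingTree (S : List (Fin n)) : Set where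
    field
      tree     : Tree n
      unique   : Unique (leaves tree)
      ⊆S       : ∀ {x} → x ∈ᵀ tree → x ∈ S
      S⊆       : ∀ {x} → x ∈ S → x ∈ᵀ tree
      displays : ∀ {a b c} → a ∈ S → b ∈ S → c ∈ S → R a b c ≡ true → OffU a b c → Consistent tree a b c

  record Split (S : List (Fin n)) : Set₁ where
    field
      Side          : Pred (Fin n) 0ℓ
      side?         : Decidable₁ Side
      some-in       : Any Side S
      some-out      : Any (∁ Side) S
      side-respects : ∀ {a b c} → a ∈ S → b ∈ S → c ∈ S → R a b c ≡ true → OffU a b c → Side a → Side b

    side-respects⁻ : ∀ {a b c} → a ∈ S → b ∈ S → c ∈ S → R a b c ≡ true → OffU a b c → ¬ Side a → ¬ Side b
    side-respects⁻ a∈ b∈ c∈ r off ¬sa =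
      ¬sa ∘ side-respects b∈ a∈ c∈ (R-sym r) λ (b∈U , a∈U , c∈U) → off (a∈U , b∈U , c∈U)

  join : ∀ {S} (sp : Split S) → DisplayingTree (filter (Split.side? sp) S) →
         DisplayingTree (filter (∁? (Split.side? sp)) S) → DisplayingTree S
  join {S} sp A B = record
    { tree     = node A.tree B.tree
    ; unique   = u
    ; ⊆S       = [ proj₁ ∘ fromA , proj₁ ∘ fromB ]′ ∘ ∈-++⁻ (leaves A.tree)
    ; S⊆       = λ {x} x∈ → [ ∈-++⁺ˡ ∘ toA x∈ , ∈-++⁺ʳ (leaves A.tree) ∘ toB x∈ ]′ (toSum (side? x))
    ; displays = displays
    }
    where
      open Split sp
      module A = DisplayingTree A
      module B = DisplayingTree B

      inA : ∀ {x} → x ∈ S → Side x → x ∈ filter side? S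
      inA = ∈-filter⁺ side?

      inB : ∀ {x} → x ∈ S → ¬ Side x → x ∈ filter (∁? side?) S
      inB = ∈-filter⁺ (∁? side?)

      fromA : ∀ {x} → x ∈ᵀ A.tree → x ∈ S × Side x
      fromA = ∈-filter⁻ side? {xs = S} ∘ A.⊆S

      fromB : ∀ {x} → x ∈ᵀ B.tree → x ∈ S × ¬ Side x
      fromB = ∈-filter⁻ (∁? side?) {xs = S} ∘ B.⊆S

      toA : ∀ {x} → x ∈ S → Side x → x ∈ᵀ A.tree
      toA x∈ sx = A.S⊆ (inA x∈ sx)

      toB : ∀ {x} → x ∈ S → ¬ Side x → x ∈ᵀ B.tree
      toB x∈ ¬sx = B.S⊆ (inB x∈ ¬sx)

      u : Unique (leaves (node A.tree B.tree))
      u = ++⁺ A.unique B.unique λ (x∈A , x∈B) → proj₂ (fromB x∈B) (proj₂ (fromA x∈A))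

      displays : ∀ {a b c} → a ∈ S → b ∈ S → c ∈ S → R a b c ≡ true → OffU a b c →
                 Consistent (node A.tree B.tree) a b c
      displays {a} {b} {c} a∈ b∈ c∈ r off with side? a | side? c
      ... | yes sa | yes sc =
        consistent-nodeˡ A.tree B.tree (A.displays (inA a∈ sa) (inA b∈ sb) (inA c∈ sc) r off)
          (λ a∈B → proj₂ (fromB a∈B) sa) (λ b∈B → proj₂ (fromB b∈B) sb) (λ c∈B → proj₂ (fromB c∈B) sc)
        where sb = side-respects a∈ b∈ c∈ r off sa
      ... | yes sa | no ¬sc =
        consistent-split A.tree B.tree u (proj₁ (R-distinct r))
          (toA a∈ sa) (toA b∈ (side-respects a∈ b∈ c∈ r off sa)) (toB c∈ ¬sc)
      ... | no ¬sa | yes sc =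
        consistent-splitʳ A.tree B.tree u (proj₁ (R-distinct r))
          (toB a∈ ¬sa) (toB b∈ (side-respects⁻ a∈ b∈ c∈ r off ¬sa)) (toA c∈ sc)
      ... | no ¬sa | no ¬sc =
        consistent-nodeʳ A.tree B.tree (B.displays (inB a∈ ¬sa) (inB b∈ ¬sb) (inB c∈ ¬sc) r off)
          (¬sa ∘ proj₂ ∘ fromA) (¬sb ∘ proj₂ ∘ fromA) (¬sc ∘ proj₂ ∘ fromA)
        where ¬sb = side-respects⁻ a∈ b∈ c∈ r off ¬sa

  inside-split : ∀ {S x y} → All (_∈ₛ U) S → x ∈ S → y ∈ S → x ≢ y → Split S
  inside-split {x = x} S⊆U x∈ y∈ x≢y = record
    { Side          = _≡ x
    ; side?         = _≟ x
    ; some-in       = lose x∈ refl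
    ; some-out      = lose y∈ (≢-sym x≢y)
    ; side-respects = λ a∈ b∈ c∈ _ off _ →
                        ⊥-elim (off (All.lookup S⊆U a∈ , All.lookup S⊆U b∈ , All.lookup S⊆U c∈))
    }

  module Pivot {S : List (Fin n)} {w} (w∈S : w ∈ S) (w∉U : w ∉ₛ U) where

    Side : Pred (Fin n) 0ℓ
    Side b = b ≡ w ⊎ Any (λ v → R w b v ≡ true) S

    side? : Decidable₁ Side
    side? b = b ≟ w ⊎-dec any? (λ v → R w b v ≟ᵇ true) S

    offU₁ : ∀ {a b} → OffU w a b
    offU₁ (w∈U , _) = w∉U w∈U

    offU₂ : ∀ {a b} → OffU a w b
    offU₂ (_ , w∈U , _) = w∉U w∈U

    offU₃ : ∀ {a b} → OffU a b w
    offU₃ (_ , _ , w∈U) = w∉U w∈U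

    side-via-w : ∀ {x y} → R x y w ≡ true → Side x → Side y
    side-via-w r (inj₁ refl) = ⊥-elim (proj₁ (proj₂ (R-distinct r)) refl)
    side-via-w {x} {y} r (inj₂ wx∣v) with find wx∣v
    ... | v , v∈ , rwxv with y ≟ v
    ...   | yes refl = ⊥-elim (R-exclusive r (R-sym rwxv))
    ...   | no  y≢v  = inj₂ (lose v∈ (R-sym (ab∣c∧ac∣d⇒bc∣d r (R-sym rwxv) y≢v offU₃ offU₂ offU₂)))

    side-respects : ∀ {a b c} → a ∈ S → b ∈ S → c ∈ S → R a b c ≡ true → OffU a b c → Side a → Side b
    side-respects {a} {b} {c} a∈ _ c∈ r off sa with a ≟ w | b ≟ w | c ≟ w
    ... | yes refl | _       | _        = inj₂ (lose c∈ r)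
    ... | no _     | yes b≡w | _        = inj₁ b≡w
    ... | no _     | no _    | yes refl = side-via-w r sa
    ... | no a≢w   | no b≢w  | no c≢w with R-total (proj₁ (R-distinct r) , a≢w , b≢w)
    ...   | inj₁ ab∣w        = side-via-w ab∣w sa
    ...   | inj₂ (inj₁ aw∣b) = inj₂ (lose c∈ (ab∣c∧ac∣d⇒bc∣d aw∣b r (≢-sym c≢w) offU₂ off offU₁))
    ...   | inj₂ (inj₂ bw∣a) = inj₂ (lose a∈ (R-sym bw∣a))

    _≺_ : Rel (Fin n) 0ℓ
    m ≺ v = R w m v ≡ true

    ≺-trans : Transitive _≺_
    ≺-trans r₁ r₂ = ab∣c∧ac∣d⇒ab∣d r₁ r₂ (λ { refl → R-exclusive r₁ r₂ }) offU₁ offU₁ offU₁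

    ≺-irrefl : Irreflexive _≡_ _≺_
    ≺-irrefl refl r = proj₂ (proj₂ (R-distinct r)) refl

    ≢w? : Decidable₁ (_≢ w)
    ≢w? b = ¬? (b ≟ w)

    ∃-other : ∀ {x y} → x ∈ S → y ∈ S → x ≢ y → ∃ λ z → z ∈ filter ≢w? S
    ∃-other {x} x∈ y∈ x≢y with x ≟ w
    ... | yes refl = _ , ∈-filter⁺ ≢w? y∈ (≢-sym x≢y)
    ... | no  x≢w  = _ , ∈-filter⁺ ≢w? x∈ x≢w

    some-out : ∀ {x y} → x ∈ S → y ∈ S → x ≢ y → Any (∁ Side) S
    some-out x∈ y∈ x≢y with ∃-maximal (λ m v → R w m v ≟ᵇ true) ≺-trans ≺-irrefl (proj₂ (∃-other x∈ y∈ x≢y))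
    ... | m , m∈ , m-max with ∈-filter⁻ ≢w? {xs = S} m∈
    ...   | m∈S , m≢w = lose m∈S [ m≢w , (λ wm∣v → let (v , v∈ , r) = find wm∣v in
                                       m-max (∈-filter⁺ ≢w? v∈ (≢-sym (proj₁ (proj₂ (R-distinct r))))) r) ]′

    split : ∀ {x y} → x ∈ S → y ∈ S → x ≢ y → Split S
    split x∈ y∈ x≢y = record
      { Side          = Side
      ; side?         = side?
      ; some-in       = lose w∈S (inj₁ refl)
      ; some-out      = some-out x∈ y∈ x≢y
      ; side-respects = side-respects
      }

  split : ∀ {S x y} → x ∈ S → y ∈ S → x ≢ y → Split S
  split {S} x∈ y∈ x≢y with all? (_∈? U) S
  ... | yes S⊆U = inside-split S⊆U x∈ y∈ x≢y
  ... | no  S⊈U with find (¬All⇒Any¬ (_∈? U) S S⊈U)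
  ...   | w , w∈S , w∉U = Pivot.split w∈S w∉U x∈ y∈ x≢y

  singleton : ∀ x → DisplayingTree (x ∷ [])
  singleton x = record
    { tree     = leaf x
    ; unique   = All.[] ∷ []
    ; ⊆S       = id
    ; S⊆       = id
    ; displays = λ { (here refl) (here refl) _ r _ → ⊥-elim (proj₁ (R-distinct r) refl) }
    }

  displayingTree : ∀ {S} → Unique S → 0 < length S → DisplayingTree S
  displayingTree {S} = wfRec (λ S → Unique S → 0 < length S → DisplayingTree S) step S
    where
      open WF.All (On.wellFounded length <-wellFounded) 0ℓ

      step : ∀ S → (∀ {S'} → length S' < length S → Unique S' → 0 < length S' → DisplayingTree S') →
             Unique S → 0 < length S → DisplayingTree S
      step (x ∷ [])     _   _ _ = singleton x
      step (x ∷ y ∷ ys) rec u _ = join sp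
        (rec (filter-notAll side? _ some-out) (filter⁺ side? u) (filter-some side? some-in))
        (rec (filter-notAll (∁? side?) _ (Any.map (λ s ¬s → ¬s s) some-in))
             (filter⁺ (∁? side?) u) (filter-some (∁? side?) some-out))
        where
          sp = split (here refl) (there (here refl)) (λ x≡y → Unique[x∷xs]⇒x∉xs u (here x≡y))
          open Split sp

lemma8 : {n : ℕ} → 1 ≤ n → (R : TripletSet n) → Dense R →
  (Cs : List (Subset n)) → ConflictPacking R Cs →
  Σ (Tree n) λ T → TreeOver ⊤ T ×
    (∀ a b c → R a b c ≡ true → ¬ Consistent T a b c →
      a ∈ₛ ⋃ Cs × b ∈ₛ ⋃ Cs × c ∈ₛ ⋃ Cs)
lemma8 {suc m} _ R dense Cs (_ , maximal) =
  tree , (unique , λ x → (λ _ → S⊆ (∈-allFin x)) , (λ _ → ∈⊤)) ,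
  λ a b c r inconsistent → decidable-stable (a ∈? ⋃ Cs ×-dec b ∈? ⋃ Cs ×-dec c ∈? ⋃ Cs) λ off →
    inconsistent (displays (∈-allFin a) (∈-allFin b) (∈-allFin c) r off)
  where
    open MaximalPacking dense (⋃ Cs) maximal
    open DisplayingTree (displayingTree (allFin⁺ (suc m)) (s≤s z≤n))
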